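{- Let $S$ and $T$ be association schemes on finite sets $X$ and $Y$, and $\phi$ an admissible morphism from $S$ to $T$. If $R\subseteq S$ is a closed subset, then $\phi(R)=\{\phi(r):r\in R\}$ is a closed subset of $T$, and for every geometric coset $W$ of $R$, $\phi(W)=\{\phi(w):w\in W\}$ is a geometric coset of $\phi(R)$. In particular, $\phi(S)$ is closed in $T$ and $\phi(X)$ is a geometric coset of $\phi(S)$.
   Context: An association scheme on a finite set $X$ is a partition $S$ of $X\times X$ into nonempty subsets such that $1_X=\{(x,x)\}\in S$; $s^*=\{(x,y):(y,x)\in s\}\in S$; and for $p,q,r\in S$ there is $a_{pq}^r\ge0$ with $|\{y:(x,y)\in p,(y,z)\in q\}|=a_{pq}^r$ whenever $(x,z)\in r$. Complex product: $PQ=\{r:a_{pq}^r>0\text{ for some }p\in P,q\in Q\}$. A nonempty $R\subseteq S$ is closed if $RR=R$. For $x\in X$, the geometric coset of closed $R$ containing $x$ is $xR=\{y:(x,y)\in r\text{ for some }r\in R\}$. A morphism from $S$ on $X$ to $T$ on $Y$ is a function $\phi:X\cup S\to Y\cup T$ with $\phi(X)\subseteq Y$, $\phi(S)\subseteq T$, $(\phi(x_1),\phi(x_2))\in\phi(s)$ whenever $(x_1,x_2)\in s$; it is admissible if whenever $(\phi(x),y)\in\phi(s)$ there is $x'\in X$ with $\phi(x')=y$ and $(x,x')\in s$. -}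

module Defs where

open import Data.Unit using (⊤)
open import Data.Nat using (ℕ; _>_)
open import Data.Fin using (Fin; _≟_)
open import Data.List using (List; length; filter; allFin)
open import Data.Product using (Σ; ∃; ∃-syntax; _×_; _,_)
open import Relation.Nullary.Decidable using (_×-dec_)
open import Relation.Binary.PropositionalEquality using (_≡_)
open import Function.Bundles using (_⇔_)

Subset : ℕ → Set₁
Subset k = Fin k → Set

_≐_ : ∀ {k} → Subset k → Subset k → Set
A ≐ B = ∀ i → A i ⇔ B i

image : ∀ {k l} → (Fin k → Fin l) → Subset k → Subset l
image f A j = ∃[ i ] (A i × f i ≡ j)

-- An association scheme on the point set X = Fin n with relation set
-- S = Fin m: rel x y is the (unique) class of S containing (x , y).
record AssocScheme : Set where
  field
    n : ℕ
    m : ℕ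
    rel      : Fin n → Fin n → Fin m
    nonempty : ∀ (s : Fin m) → ∃[ x ] ∃[ y ] (rel x y ≡ s)
    one      : Fin m
    one-spec : ∀ x y → (rel x y ≡ one) ⇔ (x ≡ y)
    star      : Fin m → Fin m
    star-spec : ∀ s x y → (rel x y ≡ star s) ⇔ (rel y x ≡ s)
    a      : Fin m → Fin m → Fin m → ℕ
    a-spec : ∀ p q r x z → rel x z ≡ r →
             length (filter (λ y → (rel x y ≟ p) ×-dec (rel y z ≟ q)) (allFin n))
               ≡ a p q r
open AssocScheme public

module _ (S : AssocScheme) where
  cplx : Subset (m S) → Subset (m S) → Subset (m S)
  cplx P Q r = ∃[ p ] ∃[ q ] (P p × Q q × a S p q r > 0)

  Closed : Subset (m S) → Set
  Closed R = (∃[ r ] R r) × (cplx R R ≐ R)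

  coset : Fin (n S) → Subset (m S) → Subset (n S)
  coset x R y = ∃[ r ] (R r × rel S x y ≡ r)

  IsGeomCoset : Subset (m S) → Subset (n S) → Set
  IsGeomCoset R W = ∃[ x ] (W ≐ coset x R)

record Morphism (S T : AssocScheme) : Set where
  field
    φX : Fin (n S) → Fin (n T)
    φS : Fin (m S) → Fin (m T)
    preserves : ∀ x₁ x₂ s → rel S x₁ x₂ ≡ s → rel T (φX x₁) (φX x₂) ≡ φS s
open Morphism public

Admissible : ∀ {S T} → Morphism S T → Set
Admissible {S} {T} φ =
  ∀ x y s → rel T (φX φ x) y ≡ φS φ s → ∃[ x′ ] (φX φ x′ ≡ y × rel S x x′ ≡ s)

full : ∀ {k} → Subset k
full _ = ⊤

module Submission where

-- Everything rests on one translation: a structure constant a p q r is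
-- positive iff, for some (equivalently every) pair (x , z) in r, there is a
-- midpoint y with (x , y) ∈ p and (y , z) ∈ q.  For a morphism φ, positivity of a p q r transfers to
-- a φ(p) φ(q) φ(r); if φ is moreover admissible, paths in T starting in φ(X)
-- lift to S, which gives the two image identities
--     φ(PQ) = φ(P) φ(Q)        and        φ(xR) = φ(x) φ(R).
-- The theorem follows: φ(R) = φ(RR) = φ(R)φ(R), and φ(W) = φ(xR) = φ(x)φ(R)
-- when W = xR; the special case R = S, W = X = xS is the last assertion.

open import Defs
open import Data.Product using (_×_; _,_; ∃; ∃-syntax; proj₂)
open import Data.Unit using (tt)
open import Data.Nat using (_>_; s≤s; z≤n)
open import Data.Fin using (Fin; _≟_)
open import Data.List using (List; _∷_; length; filter; allFin)
open import Data.List.Membership.Propositional using (_∈_)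
open import Data.List.Relation.Unary.Any using (here)
open import Data.List.Membership.Propositional.Properties using (∈-filter⁺; ∈-filter⁻; ∈-allFin)
open import Relation.Nullary.Decidable using (Dec; _×-dec_)
open import Relation.Binary.PropositionalEquality using (_≡_; refl; sym; trans; subst)
open import Relation.Binary.Structures using (IsEquivalence)
open import Function.Bundles using (_⇔_; mk⇔; Equivalence)
open import Function.Properties.Equivalence using (⇔-isEquivalence)

≐-sym : ∀ {k} {A B : Subset k} → A ≐ B → B ≐ A
≐-sym A≐B i = IsEquivalence.sym ⇔-isEquivalence (A≐B i)

≐-trans : ∀ {k} {A B C : Subset k} → A ≐ B → B ≐ C → A ≐ C
≐-trans A≐B B≐C i = IsEquivalence.trans ⇔-isEquivalence (A≐B i) (B≐C i)

image-cong : ∀ {k l} (f : Fin k → Fin l) {A B : Subset k} → A ≐ B → image f A ≐ image f B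
image-cong f A≐B j = mk⇔
  (λ { (i , Ai , fi≡j) → i , Equivalence.to (A≐B i) Ai , fi≡j })
  (λ { (i , Bi , fi≡j) → i , Equivalence.from (A≐B i) Bi , fi≡j })

member⇒length>0 : ∀ {A : Set} {y : A} {ys : List A} → y ∈ ys → length ys > 0
member⇒length>0 {ys = _ ∷ _} _ = s≤s z≤n

length>0⇒member : ∀ {A : Set} (ys : List A) → length ys > 0 → ∃[ y ] (y ∈ ys)
length>0⇒member (y ∷ _) _ = y , here refl

module SchemeFacts (S : AssocScheme) where

  midpoint? : ∀ x p q z (y : Fin (n S)) → Dec (rel S x y ≡ p × rel S y z ≡ q)
  midpoint? x p q z y = (rel S x y ≟ p) ×-dec (rel S y z ≟ q)

  midpoints : Fin (n S) → Fin (m S) → Fin (m S) → Fin (n S) → List (Fin (n S))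
  midpoints x p q z = filter (midpoint? x p q z) (allFin (n S))

  path⇒positive : ∀ {p q r x y z} → rel S x y ≡ p → rel S y z ≡ q → rel S x z ≡ r →
                  a S p q r > 0
  path⇒positive {p} {q} {r} {x} {y} {z} xy yz xz =
    subst (_> 0) (a-spec S p q r x z xz)
      (member⇒length>0 (∈-filter⁺ (midpoint? x p q z) (∈-allFin y) (xy , yz)))

  positive⇒path : ∀ {p q r x z} → rel S x z ≡ r → a S p q r > 0 →
                  ∃[ y ] (rel S x y ≡ p × rel S y z ≡ q)
  positive⇒path {p} {q} {r} {x} {z} xz apqr>0
    with length>0⇒member (midpoints x p q z) (subst (_> 0) (sym (a-spec S p q r x z xz)) apqr>0)
  ... | y , y∈ = y , proj₂ (∈-filter⁻ (midpoint? x p q z) {xs = allFin (n S)} y∈)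

  rel-diag : ∀ x → rel S x x ≡ one S
  rel-diag x = Equivalence.from (one-spec S x x) refl

  -- A pair (x₀ , z₀) ∈ t gives the path x₀ → z₀ → x₀, so a t t* 1 > 0,
  -- and then the pair (x , x) ∈ 1 has a (t , t*)-path as well.
  relation-from : ∀ t x → ∃[ z ] (rel S x z ≡ t)
  relation-from t x with nonempty S t
  ... | x₀ , z₀ , x₀z₀ with positive⇒path {t} {star S t} (rel-diag x)
                              (path⇒positive x₀z₀ (Equivalence.from (star-spec S t z₀ x₀) x₀z₀)
                                             (rel-diag x₀))
  ... | z , xz , _ = z , xz

  -- The whole relation set is closed: each r = rel x z occurs in r · 1.
  full-closed : Closed S full
  full-closed = (one S , tt) , λ r → mk⇔ (λ _ → tt) (λ _ → every-product r)
    where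
      every-product : ∀ r → cplx S full full r
      every-product r with nonempty S r
      ... | x , z , xz = r , one S , tt , tt , path⇒positive xz (rel-diag z) xz

  full-coset : IsGeomCoset S full full
  full-coset with nonempty S (one S)
  ... | x , _ = x , λ y → mk⇔ (λ _ → rel S x y , tt , refl) (λ _ → tt)

open SchemeFacts

module MorphismFacts {S T : AssocScheme} (φ : Morphism S T) where

  -- Morphisms carry (p , q)-paths to (φ p , φ q)-paths, hence preserve positivity.
  positive-preserved : ∀ {p q r} → a S p q r > 0 → a T (φS φ p) (φS φ q) (φS φ r) > 0
  positive-preserved {p} {q} {r} apqr>0 with nonempty S r
  ... | x , z , xz with positive⇒path S xz apqr>0
  ... | y , xy , yz = path⇒positive T (preserves φ x y p xy) (preserves φ y z q yz)
                                      (preserves φ x z r xz)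

  image-product⊆ : ∀ P Q t → image (φS φ) (cplx S P Q) t →
                   cplx T (image (φS φ) P) (image (φS φ) Q) t
  image-product⊆ P Q ._ (r , (p , q , Pp , Qq , apqr>0) , refl) =
    φS φ p , φS φ q , (p , Pp , refl) , (q , Qq , refl) , positive-preserved apqr>0

  image-coset⊆ : ∀ x R y → image (φX φ) (coset S x R) y → coset T (φX φ x) (image (φS φ) R) y
  image-coset⊆ x R ._ (w , (r , Rr , xw) , refl) = φS φ r , (r , Rr , refl) , preserves φ x w r xw

  module Admissibility (adm : Admissible φ) where

    -- φ(P) φ(Q) is contained in φ(PQ): for t in the product, start at some
    -- φ(x) with x the source of a p-pair, take (φ x , z′) ∈ t, find a
    -- (φ p , φ q)-path φ x → y′ → z′ and lift both of its steps into S.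
    image-product⊇ : ∀ P Q t → cplx T (image (φS φ) P) (image (φS φ) Q) t →
                     image (φS φ) (cplx S P Q) t
    image-product⊇ P Q t (._ , ._ , (p , Pp , refl) , (q , Qq , refl) , a>0)
      with nonempty S p
    ... | x , _ with relation-from T t (φX φ x)
    ... | z′ , φx-z′ with positive⇒path T φx-z′ a>0
    ... | y′ , φx-y′ , y′z′ with adm x y′ p φx-y′
    ... | x₁ , refl , xx₁ with adm x₁ z′ q y′z′
    ... | x₂ , refl , x₁x₂ =
      rel S x x₂ , (p , q , Pp , Qq , path⇒positive S xx₁ x₁x₂ refl) ,
      trans (sym (preserves φ x x₂ (rel S x x₂) refl)) φx-z′

    image-product : ∀ P Q → image (φS φ) (cplx S P Q) ≐ cplx T (image (φS φ) P) (image (φS φ) Q)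
    image-product P Q t = mk⇔ (image-product⊆ P Q t) (image-product⊇ P Q t)

    image-coset : ∀ x R → image (φX φ) (coset S x R) ≐ coset T (φX φ x) (image (φS φ) R)
    image-coset x R y = mk⇔ (image-coset⊆ x R y) from
      where
        from : coset T (φX φ x) (image (φS φ) R) y → image (φX φ) (coset S x R) y
        from (._ , (r , Rr , refl) , φx-y) with adm x y r φx-y
        ... | x′ , φx′≡y , xx′ = x′ , (r , Rr , xx′) , φx′≡y

    image-closed : ∀ R → Closed S R → Closed T (image (φS φ) R)
    image-closed R ((r , Rr) , RR≐R) =
      (φS φ r , r , Rr , refl) ,
      ≐-trans (≐-sym (image-product R R)) (image-cong (φS φ) RR≐R)

    image-geomCoset : ∀ R W → IsGeomCoset S R W → IsGeomCoset T (image (φS φ) R) (image (φX φ) W)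
    image-geomCoset R W (x , W≐xR) = φX φ x , ≐-trans (image-cong (φX φ) W≐xR) (image-coset x R)

lemma4p1 : (S T : AssocScheme) (φ : Morphism S T) → Admissible φ →
    ((R : Subset (m S)) → Closed S R →
      Closed T (image (φS φ) R)
      × ((W : Subset (n S)) → IsGeomCoset S R W →
           IsGeomCoset T (image (φS φ) R) (image (φX φ) W)))
    × Closed T (image (φS φ) full)
    × IsGeomCoset T (image (φS φ) full) (image (φX φ) full)
lemma4p1 S T φ adm =
  (λ R R-closed → image-closed R R-closed , λ W → image-geomCoset R W) ,
  image-closed full (full-closed S) ,
  image-geomCoset full full (full-coset S)
  where open MorphismFacts.Admissibility φ adm
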